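{- For every graph $G$ of order $n$, $\vec{\ell}(G) = n-\alpha(G)$.
   Context: A directed linear forest is a digraph that is a disjoint union of directed paths. For a digraph $D$, $\vec\ell(D)$ is the maximum number of arcs of a directed linear forest that is a subdigraph of $D$. For an undirected graph $G$, $\vec\ell(G) := \min\{\vec\ell(\vec G) : \vec G \text{ an orientation of } G\}$. $\alpha(G)$ is the independence number of $G$. -}

module Defs where

open import Data.Nat using (ℕ; zero; suc; _+_; _∸_; _≤_)
open import Data.Fin using (Fin; zero; suc)
open import Data.Bool using (Bool; true; false; if_then_else_; _∨_; _∧_)
open import Data.Product using (Σ; _×_; ∃)
open import Relation.Binary.PropositionalEquality using (_≡_)
open import Relation.Binary.Construct.Closure.Transitive using (TransClosure)
open import Relation.Nullary using (¬_)

record Graph (n : ℕ) : Set where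
  field
    adj    : Fin n → Fin n → Bool
    sym    : ∀ u v → adj u v ≡ adj v u
    irrefl : ∀ u → adj u u ≡ false
open Graph public

count : ∀ {m} → (Fin m → Bool) → ℕ
count {zero}  f = 0
count {suc m} f = (if f zero then 1 else 0) + count (λ i → f (suc i))

sumFin : ∀ {m} → (Fin m → ℕ) → ℕ
sumFin {zero}  f = 0
sumFin {suc m} f = f zero + sumFin (λ i → f (suc i))

Digraph : ℕ → Set
Digraph n = Fin n → Fin n → Bool

arcCount : ∀ {n} → Digraph n → ℕ
arcCount {n} D = sumFin (λ u → count (D u))

IsOrientation : ∀ {n} → Graph n → Digraph n → Set
IsOrientation G D = (∀ u v → (D u v ∨ D v u) ≡ adj G u v)
                  × (∀ u v → (D u v ∧ D v u) ≡ false)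

IsSubdigraph : ∀ {n} → Digraph n → Digraph n → Set
IsSubdigraph F D = ∀ u v → F u v ≡ true → D u v ≡ true

-- F is a directed linear forest (disjoint union of directed paths):
-- every out-degree and in-degree is at most 1 and F has no directed cycle.
IsDirectedLinearForest : ∀ {n} → Digraph n → Set
IsDirectedLinearForest {n} F =
    (∀ u v w → F u v ≡ true → F u w ≡ true → v ≡ w)
  × (∀ u v w → F v u ≡ true → F w u ≡ true → v ≡ w)
  × (∀ u → ¬ TransClosure (λ x y → F x y ≡ true) u u)

-- k = ℓ⃗(D): maximum number of arcs of a directed linear forest in D.
IsMaxLinearForestArcs : ∀ {n} → Digraph n → ℕ → Set
IsMaxLinearForestArcs D k =
    (Σ _ λ F → IsSubdigraph F D × IsDirectedLinearForest F × arcCount F ≡ k)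
  × (∀ F → IsSubdigraph F D → IsDirectedLinearForest F → arcCount F ≤ k)

-- k = ℓ⃗(G) = min over orientations D of G of ℓ⃗(D).
IsGraphLinearForestNumber : ∀ {n} → Graph n → ℕ → Set
IsGraphLinearForestNumber G k =
    (Σ _ λ D → IsOrientation G D × IsMaxLinearForestArcs D k)
  × (∀ D → IsOrientation G D → ∀ m → IsMaxLinearForestArcs D m → k ≤ m)

IsIndependent : ∀ {n} → Graph n → (Fin n → Bool) → Set
IsIndependent G S = ∀ u v → S u ≡ true → S v ≡ true → adj G u v ≡ false

IsIndependenceNumber : ∀ {n} → Graph n → ℕ → Set
IsIndependenceNumber G k =
    (Σ _ λ S → IsIndependent G S × count S ≡ k)
  × (∀ S → IsIndependent G S → count S ≤ k)

{-# OPTIONS --safe #-}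
-- Upper bound: orient G so that a maximum independent set S consists of sinks.
-- A linear forest has out-degree at most 1 everywhere and 0 on S, hence at most
-- n − α arcs.
-- Lower bound (Gallai–Milgram): every orientation has a cover by at most α
-- vertex-disjoint paths, i.e. a linear forest with at least n − α arcs. A path
-- cover with more than α endpoints has an arc u → v between two endpoints, since
-- stable sets of an orientation are independent in G. If v has no predecessor, it
-- is a one-vertex path and is appended after u. Otherwise cut v from its
-- predecessor w, shorten the cover of the remaining vertices by induction, and
-- append v after w or u: by counting, one of them is still an endpoint.
module Submission where

open import Defs hiding (sym)
open import Data.Bool using (Bool; true; false; if_then_else_; _∧_; _∨_)
open import Data.Bool.Properties
  using (∧-zeroʳ; ∧-idem; ∧-conicalˡ; ∧-conicalʳ; ¬-not; not-¬)
  renaming (_≟_ to _≟ᵇ_)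
open import Data.Fin using (Fin; zero; suc; toℕ; _≟_)
open import Data.Fin.Properties using (any?; toℕ-injective; toℕ<n)
import Data.Fin.Properties as Fin
open import Data.Maybe using (Maybe; just; nothing; is-nothing)
open import Data.Maybe.Properties using (just-injective) renaming (≡-dec to ≡-decᵐ)
open import Data.Nat using (ℕ; zero; suc; _+_; _∸_; _≤_; _<_; z≤n; s≤s; s≤s⁻¹; _<ᵇ_; _≤?_)
open import Data.Nat.Properties
  using ( ≤-refl; ≤-trans; ≤-reflexive; ≤-antisym; <-trans; <-irrefl; <-asym; <⇒≱; ≮⇒≥; ≰⇒>
        ; n<1+n; m≤m+n; m≤n+m; +-mono-≤; +-monoʳ-≤; +-suc; +-comm; +-identityʳ; +-cancelˡ-≡
        ; suc-injective; <ᵇ-reflects-<; m+n≤o⇒m≤o∸n; m≤n+o⇒m∸n≤o; +-commutativeSemigroup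
        ; module ≤-Reasoning)
open import Algebra.Properties.CommutativeSemigroup +-commutativeSemigroup using (interchange)
open import Data.Product using (Σ-syntax; ∃₂; _×_; _,_; proj₁; proj₂)
open import Data.Sum using (_⊎_; inj₁; inj₂)
open import Function using (_∘_)
open import Data.Vec.Functional using (updateAt)
open import Data.Vec.Functional.Properties using (updateAt-updates; updateAt-minimal)
open import Relation.Binary.Construct.Closure.Transitive using (TransClosure; [_]; _∷_)
open import Relation.Binary.PropositionalEquality
open import Relation.Nullary using (does; yes; no; contradiction)
open import Relation.Nullary.Reflects using (ofʸ; ofⁿ)
open import Relation.Nullary.Decidable using (_×-dec_)

infix 4 _⊆_
_⊆_ : ∀ {m} → (Fin m → Bool) → (Fin m → Bool) → Set
S ⊆ T = ∀ {i} → S i ≡ true → T i ≡ true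

⊆-reflexive : ∀ {m} {S T : Fin m → Bool} → S ≗ T → S ⊆ T
⊆-reflexive S≗T {i} Si = trans (sym (S≗T i)) Si

updateAt-cases : ∀ {m} {A : Set} (f : Fin m → A) x {c : A} {y d} →
                 updateAt f x (λ _ → c) y ≡ d → (y ≡ x × c ≡ d) ⊎ (y ≢ x × f y ≡ d)
updateAt-cases f x {y = y} e with y ≟ x
... | yes refl = inj₁ (refl , trans (sym (updateAt-updates x f)) e)
... | no y≢x   = inj₂ (y≢x , trans (sym (updateAt-minimal y x f y≢x)) e)

infixl 6 _─_
_─_ : ∀ {m} → (Fin m → Bool) → Fin m → Fin m → Bool
S ─ x = updateAt S x (λ _ → false)

─-removes : ∀ {m} (S : Fin m → Bool) x → (S ─ x) x ≡ false
─-removes S x = updateAt-updates x S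

─-keeps : ∀ {m} (S : Fin m → Bool) {x y} → y ≢ x → (S ─ x) y ≡ S y
─-keeps S {x} {y} y≢x = updateAt-minimal y x S y≢x

─-elim : ∀ {m} (S : Fin m → Bool) {x y} → (S ─ x) y ≡ true → y ≢ x × S y ≡ true
─-elim S {x} e with updateAt-cases S x e
... | inj₁ (_ , ())
... | inj₂ y≢x,Sy = y≢x,Sy

─-intro : ∀ {m} (S : Fin m → Bool) {x y} → y ≢ x → S y ≡ true → (S ─ x) y ≡ true
─-intro S y≢x Sy = trans (─-keeps S y≢x) Sy

─-⊆ : ∀ {m} {S : Fin m → Bool} {x} → S ─ x ⊆ S
─-⊆ {S = S} e = proj₂ (─-elim S e)

⊆-─ : ∀ {m} {S T : Fin m → Bool} {x} → S ⊆ T → S x ≡ false → S ⊆ T ─ x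
⊆-─ {T = T} S⊆T Sx Si = ─-intro T (λ { refl → contradiction Sx (not-¬ Si) }) (S⊆T Si)

─-⊆⇒⊆ : ∀ {m} {S T : Fin m → Bool} {x} → S ─ x ⊆ T → T x ≡ true → S ⊆ T
─-⊆⇒⊆ {S = S} {x = x} S─x⊆T Tx {i} Si with i ≟ x
... | yes refl = Tx
... | no i≢x   = S─x⊆T (─-intro S i≢x Si)

count-false : ∀ m → count {m} (λ _ → false) ≡ 0
count-false zero    = refl
count-false (suc m) = count-false m

count-cong : ∀ {m} {S T : Fin m → Bool} → S ≗ T → count S ≡ count T
count-cong {zero}  _   = refl
count-cong {suc m} S≗T = cong₂ _+_ (cong (λ b → if b then 1 else 0) (S≗T zero)) (count-cong (S≗T ∘ suc))

indicator-mono : ∀ {b c : Bool} → (b ≡ true → c ≡ true) → (if b then 1 else 0) ≤ (if c then 1 else 0)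
indicator-mono {false} _   = z≤n
indicator-mono {true}  b⇒c rewrite b⇒c refl = ≤-refl

count-mono : ∀ {m} {S T : Fin m → Bool} → S ⊆ T → count S ≤ count T
count-mono {zero}  _   = z≤n
count-mono {suc m} {S} {T} S⊆T = +-mono-≤ (indicator-mono S⊆T) (count-mono {S = S ∘ suc} {T ∘ suc} S⊆T)

count-─ : ∀ {m} (S : Fin m → Bool) {x} → S x ≡ true → count S ≡ suc (count (S ─ x))
count-─ S {zero}  Sx rewrite Sx = refl
count-─ S {suc x} Sx = trans (cong ((if S zero then 1 else 0) +_) (count-─ (S ∘ suc) Sx)) (+-suc _ _)

count-─-≡ : ∀ {m} (S : Fin m → Bool) {x y} →
            S x ≡ true → S y ≡ true → count (S ─ x) ≡ count (S ─ y)
count-─-≡ S Sx Sy = suc-injective (trans (sym (count-─ S Sx)) (count-─ S Sy))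

count-< : ∀ {m} {S T : Fin m → Bool} {x} → S ⊆ T → S x ≡ false → T x ≡ true → count S < count T
count-< {S = S} {T} {x} S⊆T Sx Tx =
  ≤-trans (s≤s (count-mono {S = S} {T ─ x} (⊆-─ {S = S} {T} {x} S⊆T Sx))) (≤-reflexive (sym (count-─ T Tx)))

count-≤1 : ∀ {m} {S : Fin m → Bool} →
           (∀ {x y} → S x ≡ true → S y ≡ true → x ≡ y) → count S ≤ 1
count-≤1 {zero}  _ = z≤n
count-≤1 {suc m} {S} unique with S zero in S0
... | false = count-≤1 λ Sx Sy → Fin.suc-injective (unique Sx Sy)
... | true  = s≤s (≤-trans (count-mono {S = S ∘ suc} {λ _ → false} none) (≤-reflexive (count-false m)))
  where
  none : S ∘ suc ⊆ λ _ → false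
  none Si = contradiction (unique Si S0) λ ()

toSet : ∀ {m} → Maybe (Fin m) → Fin m → Bool
toSet nothing  _ = false
toSet (just x) y = does (x ≟ y)

toSet-true : ∀ {m} (o : Maybe (Fin m)) {y} → toSet o y ≡ true → o ≡ just y
toSet-true (just x) {y} e with x ≟ y
... | yes refl = refl

count-toSet : ∀ {m} (o : Maybe (Fin m)) → count (toSet o) + (if is-nothing o then 1 else 0) ≡ 1
count-toSet {m} nothing = cong (_+ 1) (count-false m)
count-toSet (just x) = trans (+-identityʳ _) (count-singleton x)
  where
  count-singleton : ∀ {m} (x : Fin m) → count (λ y → does (x ≟ y)) ≡ 1
  count-singleton {suc m} zero = cong suc (count-false m)
  count-singleton (suc x) = count-singleton x

sumFin-mono : ∀ {m} {f g : Fin m → ℕ} → (∀ i → f i ≤ g i) → sumFin f ≤ sumFin g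
sumFin-mono {zero}  _   = z≤n
sumFin-mono {suc m} f≤g = +-mono-≤ (f≤g zero) (sumFin-mono (f≤g ∘ suc))

sumFin-1 : ∀ m → sumFin {m} (λ _ → 1) ≡ m
sumFin-1 zero    = refl
sumFin-1 (suc m) = cong suc (sumFin-1 m)

sumFin-+-count : ∀ {m} (f : Fin m → ℕ) (S : Fin m → Bool) →
                 sumFin f + count S ≡ sumFin (λ i → f i + (if S i then 1 else 0))
sumFin-+-count {zero}  f S = refl
sumFin-+-count {suc m} f S =
  trans (interchange (f zero) (sumFin (f ∘ suc)) (if S zero then 1 else 0) (count (S ∘ suc)))
        (cong ((f zero + (if S zero then 1 else 0)) +_) (sumFin-+-count (f ∘ suc) (S ∘ suc)))

orientBy : ∀ {n} → Graph n → (Fin n → ℕ) → Digraph n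
orientBy G key u v = adj G u v ∧ (key u <ᵇ key v)

orientBy-isOrientation : ∀ {n} (G : Graph n) (key : Fin n → ℕ) →
                         (∀ {u v} → key u ≡ key v → u ≡ v) → IsOrientation G (orientBy G key)
orientBy-isOrientation G key key-injective = one-way , not-both-ways
  where
  one-way : ∀ u v → (orientBy G key u v ∨ orientBy G key v u) ≡ adj G u v
  one-way u v rewrite Graph.sym G v u
    with adj G u v in uv | key u <ᵇ key v | <ᵇ-reflects-< (key u) (key v)
                         | key v <ᵇ key u | <ᵇ-reflects-< (key v) (key u)
  ... | false | _     | _        | _     | _        = refl
  ... | true  | true  | _        | _     | _        = refl
  ... | true  | false | _        | true  | _        = refl
  ... | true  | false | ofⁿ u≮v | false | ofⁿ v≮u
    with key-injective (≤-antisym (≮⇒≥ v≮u) (≮⇒≥ u≮v))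
  ...   | refl = contradiction (irrefl G u) (not-¬ uv)

  not-both-ways : ∀ u v → (orientBy G key u v ∧ orientBy G key v u) ≡ false
  not-both-ways u v rewrite Graph.sym G v u
    with adj G u v | key u <ᵇ key v | <ᵇ-reflects-< (key u) (key v)
                   | key v <ᵇ key u | <ᵇ-reflects-< (key v) (key u)
  ... | false | _     | _        | _     | _        = refl
  ... | true  | false | _        | _     | _        = refl
  ... | true  | true  | _        | false | _        = refl
  ... | true  | true  | ofʸ u<v | true  | ofʸ v<u = contradiction u<v (<-asym v<u)

sinksLast : ∀ {n} → (Fin n → Bool) → Fin n → ℕ
sinksLast {n} S u = if S u then n + toℕ u else toℕ u

sinksLast-injective : ∀ {n} (S : Fin n → Bool) {u v} → sinksLast S u ≡ sinksLast S v → u ≡ v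
sinksLast-injective {n} S {u} {v} = toℕ-injective ∘ cases (S u) (S v)
  where
  cases : ∀ b c → (if b then n + toℕ u else toℕ u) ≡ (if c then n + toℕ v else toℕ v) →
          toℕ u ≡ toℕ v
  cases true  true  eq = +-cancelˡ-≡ n _ _ eq
  cases false false eq = eq
  cases true  false eq = contradiction (subst (n ≤_) eq (m≤m+n n (toℕ u))) (<⇒≱ (toℕ<n v))
  cases false true  eq = contradiction (subst (n ≤_) (sym eq) (m≤m+n n (toℕ v))) (<⇒≱ (toℕ<n u))

sinksLast-sinks : ∀ {n} (G : Graph n) {S} → IsIndependent G S →
                  ∀ {u v} → S u ≡ true → orientBy G (sinksLast S) u v ≡ false
sinksLast-sinks {n} G {S} S-independent {u} {v} Su
  with adj G u v in uv | S v in Sv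
     | sinksLast S u <ᵇ sinksLast S v | <ᵇ-reflects-< (sinksLast S u) (sinksLast S v)
... | false | _     | _     | _       = refl
... | true  | true  | _     | _       = contradiction (S-independent u v Su Sv) (not-¬ uv)
... | true  | false | false | _       = refl
... | true  | false | true  | ofʸ u<v =
  contradiction (subst (λ b → (if b then n + toℕ u else toℕ u) < toℕ v) Su u<v)
                (<-asym (≤-trans (toℕ<n v) (m≤m+n n (toℕ u))))

arcCount+sinks≤n : ∀ {n} {D F : Digraph n} {S : Fin n → Bool} →
                     (∀ {u v} → S u ≡ true → D u v ≡ false) → IsSubdigraph F D →
                     (∀ u v w → F u v ≡ true → F u w ≡ true → v ≡ w) → arcCount F + count S ≤ n
arcCount+sinks≤n {n} {D} {F} {S} sinks F⊆D out≤1 = begin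
  arcCount F + count S                                  ≡⟨ sumFin-+-count (λ u → count (F u)) S ⟩
  sumFin (λ u → count (F u) + (if S u then 1 else 0))  ≤⟨ sumFin-mono at-most-one ⟩
  sumFin {n} (λ _ → 1)                                  ≡⟨ sumFin-1 n ⟩
  n                                                     ∎
  where
  open ≤-Reasoning
  at-most-one : ∀ u → count (F u) + (if S u then 1 else 0) ≤ 1
  at-most-one u with S u in Su
  ... | false = ≤-trans (≤-reflexive (+-identityʳ _)) (count-≤1 (out≤1 u _ _))
  ... | true  =
    +-mono-≤ (≤-trans (count-mono {S = F u} {λ _ → false} no-arc) (≤-reflexive (count-false n))) ≤-refl
    where
    no-arc : F u ⊆ λ _ → false
    no-arc Fuv = contradiction (sinks Su) (not-¬ (F⊆D u _ Fuv))

IsStable : ∀ {n} → Digraph n → (Fin n → Bool) → Set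
IsStable D T = ∀ u v → T u ≡ true → T v ≡ true → D u v ≡ false

stable-or-arc : ∀ {n} (D : Digraph n) (T : Fin n → Bool) →
                IsStable D T ⊎ ∃₂ λ u v → T u ≡ true × T v ≡ true × D u v ≡ true
stable-or-arc D T with any? (λ u → any? (λ v → T u ≟ᵇ true ×-dec T v ≟ᵇ true ×-dec D u v ≟ᵇ true))
... | yes (u , v , arc) = inj₂ (u , v , arc)
... | no no-arc         = inj₁ λ u v Tu Tv → ¬-not λ Duv → no-arc (u , v , Tu , Tv , Duv)

module GallaiMilgram {n} (D : Digraph n) (loopless : ∀ u → D u u ≡ false) where

  arc-≢ : ∀ {u v} → D u v ≡ true → u ≢ v
  arc-≢ uv refl = contradiction (loopless _) (not-¬ uv)

  ends : (Fin n → Bool) → (Fin n → Maybe (Fin n)) → Fin n → Bool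
  ends W next y = W y ∧ is-nothing (next y)

  ends-─ : ∀ W next v → ends (W ─ v) next ≗ ends W next ─ v
  ends-─ W next v y with y ≟ v
  ... | yes refl = trans (cong (_∧ _) (─-removes W v)) (sym (─-removes (ends W next) v))
  ... | no y≢v   = trans (cong (_∧ _) (─-keeps W y≢v)) (sym (─-keeps (ends W next) y≢v))

  ends-updateAt : ∀ W next {x} o {y} → y ≢ x → ends W (updateAt next x (λ _ → o)) y ≡ ends W next y
  ends-updateAt W next {x} o {y} y≢x = cong (λ z → W y ∧ is-nothing z) (updateAt-minimal y x next y≢x)

  -- Vertex-disjoint paths covering W: next u is the successor of u, and rank
  -- increases along paths, which rules out cycles.
  record PathCover (W : Fin n → Bool) : Set where
    field
      next           : Fin n → Maybe (Fin n)
      rank           : Fin n → ℕ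
      next-arc       : ∀ {u v} → next u ≡ just v → D u v ≡ true
      next-within    : ∀ {u v} → next u ≡ just v → W u ≡ true × W v ≡ true
      next-injective : ∀ {u u′ v} → next u ≡ just v → next u′ ≡ just v → u ≡ u′
      next-rank      : ∀ {u v} → next u ≡ just v → rank u < rank v

    endpoints : Fin n → Bool
    endpoints = ends W next

    endpoint-∈ : ∀ {y} → endpoints y ≡ true → W y ≡ true
    endpoint-∈ {y} = ∧-conicalˡ (W y) _

    endpoint-next : ∀ {y} → endpoints y ≡ true → next y ≡ nothing
    endpoint-next {y} e with next y
    ... | nothing = refl
    ... | just _  = contradiction (∧-conicalʳ (W y) false e) λ ()

    endpoint-intro : ∀ {y} → W y ≡ true → next y ≡ nothing → endpoints y ≡ true
    endpoint-intro Wy ny = cong₂ _∧_ Wy (cong is-nothing ny)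

  open PathCover

  next-just≢nothing : ∀ {W} (C : PathCover W) {u u′ v} →
                      next C u ≡ just u′ → next C v ≡ nothing → u ≢ v
  next-just≢nothing C e e′ refl = contradiction (trans (sym e) e′) λ ()

  Isolated : ∀ {W} → PathCover W → Fin n → Set
  Isolated C v = next C v ≡ nothing × (∀ {u} → next C u ≢ just v)

  restrict : ∀ {W W′} (C : PathCover W) →
             (∀ {u v} → next C u ≡ just v → W′ u ≡ true × W′ v ≡ true) → PathCover W′
  restrict C within = record
    { next = next C ; rank = rank C ; next-arc = next-arc C ; next-within = within
    ; next-injective = next-injective C ; next-rank = next-rank C }

  drop : ∀ {W v} (C : PathCover W) → Isolated C v → PathCover (W ─ v)
  drop {W} {v} C (v-no-next , v-no-prev) = restrict C within
    where
    within : ∀ {u u′} → next C u ≡ just u′ → (W ─ v) u ≡ true × (W ─ v) u′ ≡ true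
    within e = ─-intro W (next-just≢nothing C e v-no-next) (proj₁ (next-within C e))
             , ─-intro W (λ { refl → v-no-prev e }) (proj₂ (next-within C e))

  lift : ∀ {W v} → PathCover (W ─ v) → PathCover W
  lift {W} C = restrict C λ e →
    ─-⊆ {S = W} (proj₁ (next-within C e)) , ─-⊆ {S = W} (proj₂ (next-within C e))

  ─-isolated : ∀ {W v} (C : PathCover (W ─ v)) → Isolated C v
  ─-isolated {W} {v} C = v-no-next , λ e → outside (proj₂ (next-within C e))
    where
    outside : (W ─ v) v ≢ true
    outside Wv = contradiction (─-removes W v) (not-¬ Wv)
    v-no-next : next C v ≡ nothing
    v-no-next with next C v in e
    ... | nothing = refl
    ... | just _  = contradiction (proj₁ (next-within C e)) outside

  detach : ∀ {W} → PathCover W → Fin n → PathCover W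
  detach C w = record
    { next = next′ ; rank = rank C
    ; next-arc = λ e → next-arc C (old e) ; next-within = λ e → next-within C (old e)
    ; next-injective = λ e e′ → next-injective C (old e) (old e′) ; next-rank = λ e → next-rank C (old e) }
    where
    next′ = updateAt (next C) w (λ _ → nothing)
    old : ∀ {u v} → next′ u ≡ just v → next C u ≡ just v
    old e with updateAt-cases (next C) w e
    ... | inj₁ (_ , ())
    ... | inj₂ (_ , e′) = e′

  attach : ∀ {W} (C : PathCover W) {x v} →
           endpoints C x ≡ true → W v ≡ true → Isolated C v → D x v ≡ true → PathCover W
  attach {W} C {x} {v} x-end v∈W (v-no-next , v-no-prev) xv = record
    { next = next′ ; rank = rank′ ; next-arc = arc ; next-within = within
    ; next-injective = injective ; next-rank = increasing }
    where
    next′ = updateAt (next C) x (λ _ → just v)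
    rank′ = updateAt (rank C) v (λ _ → suc (rank C x))
    arc : ∀ {u u′} → next′ u ≡ just u′ → D u u′ ≡ true
    arc e with updateAt-cases (next C) x e
    ... | inj₁ (refl , refl) = xv
    ... | inj₂ (_ , e′)      = next-arc C e′
    within : ∀ {u u′} → next′ u ≡ just u′ → W u ≡ true × W u′ ≡ true
    within e with updateAt-cases (next C) x e
    ... | inj₁ (refl , refl) = endpoint-∈ C x-end , v∈W
    ... | inj₂ (_ , e′)      = next-within C e′
    injective : ∀ {u u′ u″} → next′ u ≡ just u″ → next′ u′ ≡ just u″ → u ≡ u′
    injective e₁ e₂ with updateAt-cases (next C) x e₁ | updateAt-cases (next C) x e₂
    ... | inj₁ (refl , refl) | inj₁ (refl , _)    = refl
    ... | inj₁ (refl , refl) | inj₂ (_ , e₂′)     = contradiction e₂′ v-no-prev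
    ... | inj₂ (_ , e₁′)     | inj₁ (refl , refl) = contradiction e₁′ v-no-prev
    ... | inj₂ (_ , e₁′)     | inj₂ (_ , e₂′)     = next-injective C e₁′ e₂′
    increasing : ∀ {u u′} → next′ u ≡ just u′ → rank′ u < rank′ u′
    increasing e with updateAt-cases (next C) x e
    ... | inj₁ (refl , refl) =
      subst₂ _<_ (sym (updateAt-minimal x v (rank C) (arc-≢ xv))) (sym (updateAt-updates v (rank C)))
                 (n<1+n (rank C x))
    ... | inj₂ (_ , e′) =
      subst₂ _<_ (sym (updateAt-minimal _ v (rank C) (next-just≢nothing C e′ v-no-next)))
                 (sym (updateAt-minimal _ v (rank C) λ { refl → v-no-prev e′ }))
                 (next-rank C e′)

  attach-endpoints : ∀ {W} (C : PathCover W) {x v} (x-end : endpoints C x ≡ true) (v∈W : W v ≡ true)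
                     (iso : Isolated C v) (xv : D x v ≡ true) →
                     endpoints (attach C x-end v∈W iso xv) ≗ endpoints C ─ x
  attach-endpoints {W} C {x} x-end _ _ _ y with y ≟ x
  ... | yes refl = trans (cong (λ o → W x ∧ is-nothing o) (updateAt-updates x (next C)))
                         (trans (∧-zeroʳ (W x)) (sym (─-removes (endpoints C) x)))
  ... | no y≢x   = trans (ends-updateAt W (next C) _ y≢x) (sym (─-keeps (endpoints C) y≢x))

  cut : ∀ {W} (C : PathCover W) {w v} → next C w ≡ just v → endpoints C v ≡ true →
        Σ[ C₀ ∈ PathCover (W ─ v) ]
          count (endpoints C₀) ≡ count (endpoints C) × endpoints C₀ w ≡ true ×
          endpoints C ─ v ⊆ endpoints C₀ × endpoints C₀ ─ w ⊆ endpoints C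
  cut {W} C {w} {v} wv v-end = drop C′ isolated , same-count , T₀w , T─v⊆T₀ , T₀─w⊆T
    where
    C′ = detach C w
    T = endpoints C
    M = endpoints C′
    T₀ = ends (W ─ v) (next C′)
    v≢w : v ≢ w
    v≢w = arc-≢ (next-arc C wv) ∘ sym
    isolated : Isolated C′ v
    isolated = trans (updateAt-minimal v w (next C) v≢w) (endpoint-next C v-end) , no-prev
      where
      no-prev : ∀ {u} → next C′ u ≢ just v
      no-prev e with updateAt-cases (next C) w e
      ... | inj₁ (_ , ())
      ... | inj₂ (u≢w , e′) = u≢w (next-injective C e′ wv)
    T≗M─w : T ≗ M ─ w
    T≗M─w y with y ≟ w
    ... | yes refl =
      trans (cong (λ o → W w ∧ is-nothing o) wv) (trans (∧-zeroʳ (W w)) (sym (─-removes M w)))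
    ... | no y≢w   = trans (sym (ends-updateAt W (next C) nothing y≢w)) (sym (─-keeps M y≢w))
    T₀≗M─v : T₀ ≗ M ─ v
    T₀≗M─v = ends-─ W (next C′) v
    Mw : M w ≡ true
    Mw = endpoint-intro C′ (proj₁ (next-within C wv)) (updateAt-updates w (next C))
    Mv : M v ≡ true
    Mv = endpoint-intro C′ (endpoint-∈ C v-end) (proj₁ isolated)
    same-count : count T₀ ≡ count T
    same-count = trans (count-cong T₀≗M─v) (trans (count-─-≡ M Mv Mw) (sym (count-cong T≗M─w)))
    T₀w : T₀ w ≡ true
    T₀w = trans (T₀≗M─v w) (─-intro M (arc-≢ (next-arc C wv)) Mw)
    T─v⊆T₀ : T ─ v ⊆ T₀
    T─v⊆T₀ {y} e = let y≢v , Ty = ─-elim T e in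
      trans (T₀≗M─v y) (─-intro M y≢v (─-⊆ {S = M} (⊆-reflexive T≗M─w Ty)))
    T₀─w⊆T : T₀ ─ w ⊆ T
    T₀─w⊆T {y} e = let y≢w , T₀y = ─-elim T₀ e in
      ⊆-reflexive (sym ∘ T≗M─w) (─-intro M y≢w (─-⊆ {S = M} (⊆-reflexive T₀≗M─v T₀y)))

  extend : ∀ {W v x} (C : PathCover (W ─ v)) → W v ≡ true → endpoints C x ≡ true → D x v ≡ true →
           Σ[ C′ ∈ PathCover W ]
             count (endpoints C′) ≡ count (endpoints C) × endpoints C′ ─ v ⊆ endpoints C ─ x
  extend {W} {v} {x} C v∈W x-end xv = C′ , same-count , subset
    where
    L = endpoints (lift C)
    T = endpoints C
    T≗L─v : T ≗ L ─ v
    T≗L─v = ends-─ W (next C) v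
    Lx : L x ≡ true
    Lx = ─-⊆ {S = L} (⊆-reflexive T≗L─v x-end)
    Lv : L v ≡ true
    Lv = endpoint-intro (lift C) v∈W (proj₁ (─-isolated C))
    C′ = attach (lift C) Lx v∈W (─-isolated C) xv
    T′≗L─x : endpoints C′ ≗ L ─ x
    T′≗L─x = attach-endpoints (lift C) Lx v∈W (─-isolated C) xv
    same-count : count (endpoints C′) ≡ count T
    same-count = trans (count-cong T′≗L─x) (trans (count-─-≡ L Lx Lv) (sym (count-cong T≗L─v)))
    subset : endpoints C′ ─ v ⊆ T ─ x
    subset {y} e = let y≢v , T′y = ─-elim (endpoints C′) e
                       y≢x , Ly = ─-elim L (⊆-reflexive T′≗L─x T′y) in
      ─-intro T y≢x (trans (T≗L─v y) (─-intro L y≢v Ly))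

  FewerEnds : ∀ {W} → PathCover W → Set
  FewerEnds {W} C =
    Σ[ C′ ∈ PathCover W ] suc (count (endpoints C′)) ≡ count (endpoints C) × endpoints C′ ⊆ endpoints C

  attach-fewer : ∀ {W} (C : PathCover W) {x v} →
                 endpoints C x ≡ true → W v ≡ true → Isolated C v → D x v ≡ true → FewerEnds C
  attach-fewer C {x} x-end v∈W iso xv =
    attach C x-end v∈W iso xv ,
    trans (cong suc (count-cong T′≗T─x)) (sym (count-─ (endpoints C) x-end)) ,
    λ e → ─-⊆ {S = endpoints C} (⊆-reflexive T′≗T─x e)
    where
    T′≗T─x = attach-endpoints C x-end v∈W iso xv

  splice : ∀ {W} (C : PathCover W) {u v w} → endpoints C u ≡ true → endpoints C v ≡ true →
           D u v ≡ true → next C w ≡ just v →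
           ((C₀ : PathCover (W ─ v)) → count (endpoints C₀) ≡ count (endpoints C) → FewerEnds C₀) →
           FewerEnds C
  splice {W} C {u} {v} {w} u-end v-end uv wv shorten with cut C wv v-end
  ... | C₀ , same-count , T₀w , T─v⊆T₀ , T₀─w⊆T = reattach (shorten C₀ same-count)
    where
    T₀ = endpoints C₀
    finish : (C₁ : PathCover (W ─ v)) →
             suc (count (endpoints C₁)) ≡ count T₀ → endpoints C₁ ⊆ T₀ →
             ∀ {x} → endpoints C₁ x ≡ true → D x v ≡ true →
             (∀ {y} → (endpoints C₁ ─ x) y ≡ true → y ≢ w) → FewerEnds C
    finish C₁ shrink T₁⊆T₀ x-end xv avoids-w with extend C₁ (endpoint-∈ C v-end) x-end xv
    ... | C′ , same , T′─v⊆T₁─x =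
      C′ , trans (cong suc same) (trans shrink same-count) ,
      ─-⊆⇒⊆ {S = endpoints C′} {endpoints C} {v} T′─v⊆T v-end
      where
      T′─v⊆T : endpoints C′ ─ v ⊆ endpoints C
      T′─v⊆T e = let e₁ = T′─v⊆T₁─x e in
        T₀─w⊆T (─-intro T₀ (avoids-w e₁) (T₁⊆T₀ (─-⊆ {S = endpoints C₁} e₁)))
    u≢w : u ≢ w
    u≢w = next-just≢nothing C wv (endpoint-next C u-end) ∘ sym
    T₀u : T₀ u ≡ true
    T₀u = T─v⊆T₀ (─-intro (endpoints C) (arc-≢ uv) u-end)
    reattach : FewerEnds C₀ → FewerEnds C
    reattach (C₁ , shrink , T₁⊆T₀) with endpoints C₁ w in T₁w | endpoints C₁ u in T₁u
    ... | true  | _    = finish C₁ shrink T₁⊆T₀ T₁w (next-arc C wv) (proj₁ ∘ ─-elim (endpoints C₁))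
    ... | false | true = finish C₁ shrink T₁⊆T₀ T₁u uv
                           λ e → λ { refl → contradiction T₁w (not-¬ (─-⊆ {S = endpoints C₁} e)) }
    -- Otherwise C₁ would have lost both w and u, two endpoints of C₀ rather than one.
    ... | false | false = contradiction
      (count-< {S = endpoints C₁} {T₀ ─ w} {u}
               (⊆-─ {S = endpoints C₁} {T₀} {w} T₁⊆T₀ T₁w) T₁u (─-intro T₀ u≢w T₀u))
      (<-irrefl (suc-injective (trans shrink (count-─ T₀ T₀w))))

  module _ (a : ℕ) (stable≤a : ∀ T → IsStable D T → count T ≤ a) where

    fewer-ends : ∀ k {W} → count W < k → (C : PathCover W) → a < count (endpoints C) → FewerEnds C
    fewer-ends (suc k) {W} |W|<k C many with stable-or-arc D (endpoints C)
    ... | inj₁ stable = contradiction (stable≤a _ stable) (<⇒≱ many)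
    ... | inj₂ (u , v , u-end , v-end , uv) with any? (λ w → ≡-decᵐ _≟_ (next C w) (just v))
    ...   | no no-prev =
      attach-fewer C u-end (endpoint-∈ C v-end) (endpoint-next C v-end , λ e → no-prev (_ , e)) uv
    ...   | yes (w , wv) =
      splice C u-end v-end uv wv λ C₀ same → fewer-ends k smaller C₀ (subst (a <_) (sym same) many)
      where
      smaller : count (W ─ v) < k
      smaller = subst (_≤ k) (count-─ W (endpoint-∈ C v-end)) (s≤s⁻¹ |W|<k)

    few-ends : ∀ k {W} (C : PathCover W) → count (endpoints C) ≤ a + k →
               Σ[ C′ ∈ PathCover W ] count (endpoints C′) ≤ a
    few-ends zero    C ≤a = C , ≤-trans ≤a (≤-reflexive (+-identityʳ a))
    few-ends (suc k) {W} C ≤a+k with count (endpoints C) ≤? a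
    ... | yes ≤a = C , ≤a
    ... | no ≰a with fewer-ends (suc (count W)) ≤-refl C (≰⇒> ≰a)
    ...   | C′ , shrink , _ =
      few-ends k C′ (s≤s⁻¹ (≤-trans (≤-reflexive shrink) (≤-trans ≤a+k (≤-reflexive (+-suc a k)))))

  singletons : ∀ {W} → PathCover W
  singletons = record
    { next = λ _ → nothing ; rank = λ _ → 0 ; next-arc = λ () ; next-within = λ ()
    ; next-injective = λ () ; next-rank = λ () }

  arcs : ∀ {W} → PathCover W → Digraph n
  arcs C u = toSet (next C u)

  arc-next : ∀ {W} (C : PathCover W) {u v} → arcs C u v ≡ true → next C u ≡ just v
  arc-next C {u} = toSet-true (next C u)

  rank-increases : ∀ {W} (C : PathCover W) {u v} →
                   TransClosure (λ x y → arcs C x y ≡ true) u v → rank C u < rank C v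
  rank-increases C [ e ]        = next-rank C (arc-next C e)
  rank-increases C (e ∷ path) = <-trans (next-rank C (arc-next C e)) (rank-increases C path)

  arcs-forest : ∀ {W} (C : PathCover W) → IsDirectedLinearForest (arcs C)
  arcs-forest C = (λ _ _ _ e₁ e₂ → just-injective (trans (sym (arc-next C e₁)) (arc-next C e₂)))
                , (λ _ _ _ e₁ e₂ → next-injective C (arc-next C e₁) (arc-next C e₂))
                , λ _ cycle → <-irrefl refl (rank-increases C cycle)

  n≤arcCount+endpoints : (C : PathCover (λ _ → true)) → n ≤ arcCount (arcs C) + count (endpoints C)
  n≤arcCount+endpoints C = begin
    n                                                                      ≡⟨ sym (sumFin-1 n) ⟩
    sumFin {n} (λ _ → 1)                                                   ≤⟨ sumFin-mono one ⟩
    sumFin (λ u → count (arcs C u) + (if endpoints C u then 1 else 0))  ≡⟨ sym (sumFin-+-count _ (endpoints C)) ⟩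
    arcCount (arcs C) + count (endpoints C)                               ∎
    where
    open ≤-Reasoning
    one : ∀ u → 1 ≤ count (arcs C u) + (if endpoints C u then 1 else 0)
    one u = ≤-reflexive (sym (count-toSet (next C u)))

  gallai-milgram : ∀ a → (∀ T → IsStable D T → count T ≤ a) →
                   Σ[ F ∈ Digraph n ] IsSubdigraph F D × IsDirectedLinearForest F × n ∸ a ≤ arcCount F
  gallai-milgram a stable≤a with few-ends a stable≤a (count {n} (λ _ → true)) singletons (m≤n+m _ a)
  ... | C , few = arcs C , (λ _ _ e → next-arc C (arc-next C e)) , arcs-forest C ,
                  m≤n+o⇒m∸n≤o n a (begin
                    n                                        ≤⟨ n≤arcCount+endpoints C ⟩
                    arcCount (arcs C) + count (endpoints C)  ≤⟨ +-monoʳ-≤ (arcCount (arcs C)) few ⟩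
                    arcCount (arcs C) + a                    ≡⟨ +-comm (arcCount (arcs C)) a ⟩
                    a + arcCount (arcs C)                    ∎)
    where open ≤-Reasoning

open GallaiMilgram using (gallai-milgram)

module _ {n} (G : Graph n) (D : Digraph n) (orientation : IsOrientation G D) where

  orientation-loopless : ∀ u → D u u ≡ false
  orientation-loopless u = trans (sym (∧-idem (D u u))) (proj₂ orientation u u)

  orientation-stable⇒independent : ∀ {T} → IsStable D T → IsIndependent G T
  orientation-stable⇒independent T-stable u v Tu Tv =
    trans (sym (proj₁ orientation u v)) (cong₂ _∨_ (T-stable u v Tu Tv) (T-stable v u Tv Tu))

  orientation-longLinearForest : ∀ {a} → (∀ S → IsIndependent G S → count S ≤ a) →
                                 Σ[ F ∈ Digraph n ] IsSubdigraph F D × IsDirectedLinearForest F × n ∸ a ≤ arcCount F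
  orientation-longLinearForest {a} α≤a =
    gallai-milgram D orientation-loopless a (λ T → α≤a T ∘ orientation-stable⇒independent)

mainTheorem10 : (n : ℕ) (G : Graph n) (a : ℕ) → IsIndependenceNumber G a → IsGraphLinearForestNumber G (n ∸ a)
mainTheorem10 n G a ((S , S-independent , |S|≡a) , α≤a) = (D₀ , D₀-orientation , D₀-maximum) , minimal
  where
  D₀ = orientBy G (sinksLast S)
  D₀-orientation = orientBy-isOrientation G (sinksLast S) (sinksLast-injective S)

  few : ∀ F → IsSubdigraph F D₀ → IsDirectedLinearForest F → arcCount F ≤ n ∸ a
  few F F⊆D₀ (out≤1 , _) = m+n≤o⇒m≤o∸n (arcCount F)
    (subst (λ k → arcCount F + k ≤ n) |S|≡a
           (arcCount+sinks≤n (sinksLast-sinks G S-independent) F⊆D₀ out≤1))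

  D₀-maximum : IsMaxLinearForestArcs D₀ (n ∸ a)
  D₀-maximum with orientation-longLinearForest G D₀ D₀-orientation α≤a
  ... | F , F⊆D₀ , forest , many = (F , F⊆D₀ , forest , ≤-antisym (few F F⊆D₀ forest) many) , few

  minimal : ∀ D → IsOrientation G D → ∀ m → IsMaxLinearForestArcs D m → n ∸ a ≤ m
  minimal D orientation m (_ , ≤m) with orientation-longLinearForest G D orientation α≤a
  ... | F , F⊆D , forest , many = ≤-trans many (≤m F F⊆D forest)
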